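{- Let $T$ be a Galois word and let $k\ge2$ be a rational number such that $k|T|$ is an integer. Let $P=\mathrm{SPref}(T^k)$. Then $|P|\ge|T|$.
   Context: For a word $T$ and rational $k$ with $k|T|\in\mathbb{Z}$, $T^k$ is the prefix of length $k|T|$ of the infinite repetition $T^\omega$. Alternating order: for words $S,T$ with $S^\omega\neq T^\omega$, let $j$ be the first position with $S^\omega[j]\neq T^\omega[j]$; $S\prec_{\mathrm{alt}}T$ if $j$ is odd and $S^\omega[j]<T^\omega[j]$, or $j$ is even and $S^\omega[j]>T^\omega[j]$. $S=_{\mathrm{alt}}T$ if $S^\omega=T^\omega$; $\preceq_{\mathrm{alt}}$ means $\prec_{\mathrm{alt}}$ or $=_{\mathrm{alt}}$, and $\succeq_{\mathrm{alt}}$ is its reverse. A word is Galois if it is strictly smaller with respect to $\prec_{\mathrm{alt}}$ than all its other cyclic rotations. For a nonempty word $W$, $\mathrm{SPref}(W)$ is the shortest nonempty prefix $P$ of $W$ such that $P\succeq_{\mathrm{alt}}W$ if $|P|$ is even and $P\preceq_{\mathrm{alt}}W$ if $|P|$ is odd. -}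

module Defs where

open import Data.Nat using (ℕ; zero; suc; _<_; _≤_; _>_; _%_)
open import Data.Nat.DivMod using ()
open import Data.List using (List; []; _∷_; length; take; drop; _++_; map; upTo)
open import Data.Product using (Σ; _×_; ∃-syntax)
open import Relation.Binary.PropositionalEquality using (_≡_; _≢_)
open import Relation.Nullary using (¬_)
open import Data.Sum using (_⊎_)

Word : Set
Word = List ℕ

-- Letter at position i (0-based) of a finite word; 0 if out of range.
at : Word → ℕ → ℕ
at []       _       = 0
at (a ∷ _)  zero    = a
at (_ ∷ w)  (suc i) = at w i

-- The infinite power W^ω as a function ℕ → ℕ (0-based), for nonempty W.
omega : Word → ℕ → ℕ
omega []        i = 0
omega w@(_ ∷ _) i = at w (i % length w)

-- T^k with k|T| = m : the prefix of length m of T^ω.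
pow : Word → ℕ → Word
pow T m = map (omega T) (upTo m)

rot : ℕ → Word → Word
rot i T = drop i T ++ take i T

_=alt_ : Word → Word → Set
S =alt T = ∀ i → omega S i ≡ omega T i

-- 0-based parity: 0-based index j even  ⇔  1-based position j+1 odd.
Even : ℕ → Set
Even j = j % 2 ≡ 0

-- S ≺alt T : first difference at 0-based j; if j even (1-based odd) then S<T, else S>T.
_≺alt_ : Word → Word → Set
S ≺alt T = ∃[ j ] ((∀ i → i < j → omega S i ≡ omega T i)
                 × ((Even j × omega S j < omega T j)
                    ⊎ (¬ Even j × omega S j > omega T j)))

_≼alt_ : Word → Word → Set
S ≼alt T = (S ≺alt T) ⊎ (S =alt T)

Galois : Word → Set
Galois T = ∀ i → 0 < i → i < length T → T ≺alt rot i T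

SPrefCond : Word → ℕ → Set
SPrefCond W p = (Even p → W ≼alt take p W) × (¬ Even p → take p W ≼alt W)

-- IsSPref W p : SPref(W) is the prefix of W of length p, i.e. p is the least
-- p with 1 ≤ p ≤ |W| satisfying SPrefCond.
IsSPref : Word → ℕ → Set
IsSPref W p = (0 < p) × (p ≤ length W) × SPrefCond W p
              × (∀ q → 0 < q → q < p → ¬ SPrefCond W q)

{-# OPTIONS --safe #-}
-- Suppose a prefix P of T^k of length p < |T| satisfied the SPref condition.
-- As T is Galois, T^ω and its shift by p (the ω-power of the rotation by p)
-- first differ at some j < |T|.  Hence T^ω has period p up to position p + j,
-- so P^ω and T^k first differ at position p + j, where P^ω carries T^ω[j] and
-- T^k carries T^ω[p + j]; k ≥ 2 makes p + j < |T^k|.  The parities of j and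
-- p + j agree iff p is even, so P ≺alt T^k for even p and T^k ≺alt P for odd
-- p: exactly the opposite of what the SPref condition demands.
module Submission where

open import Defs
open import Data.Nat using (ℕ; zero; suc; _<_; _≤_; _>_; _*_; _+_; _∸_; _%_; _/_; s≤s; z<s; NonZero; >-nonZero⁻¹; _<?_; _≤?_; _≟_)
open import Data.Nat.Properties
open import Data.Nat.DivMod using (m<n⇒m%n≡m; m%n<n; [m+n]%n≡m%n; m≡m%n+[m/n]*n)
open import Algebra.Properties.CommutativeSemigroup +-commutativeSemigroup using (x∙yz≈y∙xz)
open import Data.List using ([]; _∷_; length; take; drop; _++_; applyUpTo)
open import Data.List.Properties using (length-map; length-applyUpTo; map-applyUpTo; length-take; length-drop; length-++; take++drop≡id)
open import Data.Product using (_×_; _,_; proj₁; proj₂)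
open import Data.Sum using (_⊎_; inj₁; inj₂)
open import Data.Empty using (⊥-elim)
open import Function using (id; _∘′_)
open import Relation.Nullary using (¬_; yes; no)
open import Relation.Binary using (tri<; tri≈; tri>)
open import Relation.Binary.PropositionalEquality
open ≡-Reasoning

_<alt[_]_ : ℕ → ℕ → ℕ → Set
a <alt[ j ] b = (Even j × a < b) ⊎ (¬ Even j × a > b)

even⇒odd-suc : ∀ j → Even j → ¬ Even (suc j)
even⇒odd-suc zero          _ ()
even⇒odd-suc (suc zero)    ()
even⇒odd-suc (suc (suc j)) = even⇒odd-suc j

odd⇒even-suc : ∀ j → ¬ Even j → Even (suc j)
odd⇒even-suc zero          odd = ⊥-elim (odd refl)
odd⇒even-suc (suc zero)    _   = refl
odd⇒even-suc (suc (suc j)) = odd⇒even-suc j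

<alt⇒≢ : ∀ {j a b} → a <alt[ j ] b → a ≢ b
<alt⇒≢ (inj₁ (_ , a<b)) = <⇒≢ a<b
<alt⇒≢ (inj₂ (_ , a>b)) = ≢-sym (<⇒≢ a>b)

<alt-asym : ∀ {j a b} → a <alt[ j ] b → ¬ b <alt[ j ] a
<alt-asym (inj₁ (_    , a<b)) (inj₁ (_    , b<a)) = <-asym a<b b<a
<alt-asym (inj₁ (even , _))   (inj₂ (odd  , _))   = odd even
<alt-asym (inj₂ (odd  , _))   (inj₁ (even , _))   = odd even
<alt-asym (inj₂ (_    , a>b)) (inj₂ (_    , b>a)) = <-asym a>b b>a

<alt-suc : ∀ j {a b} → a <alt[ j ] b → b <alt[ suc j ] a
<alt-suc j (inj₁ (even , a<b)) = inj₂ (even⇒odd-suc j even , a<b)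
<alt-suc j (inj₂ (odd  , a>b)) = inj₁ (odd⇒even-suc j odd , a>b)

<alt-+even : ∀ p j {a b} → Even p → a <alt[ j ] b → a <alt[ p + j ] b
<alt-+even zero          j _    a<b = a<b
<alt-+even (suc (suc p)) j even a<b = <alt-suc (suc (p + j)) (<alt-suc (p + j) (<alt-+even p j even a<b))

<alt-+odd : ∀ p j {a b} → ¬ Even p → a <alt[ j ] b → b <alt[ p + j ] a
<alt-+odd zero          j odd _   = ⊥-elim (odd refl)
<alt-+odd (suc zero)    j _   a<b = <alt-suc j a<b
<alt-+odd (suc (suc p)) j odd a<b = <alt-suc (suc (p + j)) (<alt-suc (p + j) (<alt-+odd p j odd a<b))

-- S ≺alt T unfolds to ∃[ j ] (omega S ≺alt[ j ] omega T).
_≺alt[_]_ : (ℕ → ℕ) → ℕ → (ℕ → ℕ) → Set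
f ≺alt[ j ] g = (∀ i → i < j → f i ≡ g i) × f j <alt[ j ] g j

≺alt[]-asym : ∀ {f g j k} → f ≺alt[ j ] g → ¬ g ≺alt[ k ] f
≺alt[]-asym {j = j} {k} (f≡g , fj<gj) (g≡f , gk<fk) with <-cmp j k
... | tri< j<k _ _    = <alt⇒≢ {j} fj<gj (sym (g≡f j j<k))
... | tri≈ _ refl _   = <alt-asym {j} fj<gj gk<fk
... | tri> _ _ k<j    = <alt⇒≢ {k} gk<fk (sym (f≡g k k<j))

≺alt[]-local : ∀ {f f′ g g′ j} → (∀ i → i ≤ j → f i ≡ f′ i) → (∀ i → i ≤ j → g i ≡ g′ i) →
               f ≺alt[ j ] g → f′ ≺alt[ j ] g′
≺alt[]-local {j = j} f≡f′ g≡g′ (f≡g , fj<gj) =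
  (λ i i<j → trans (sym (f≡f′ i (<⇒≤ i<j))) (trans (f≡g i i<j) (g≡g′ i (<⇒≤ i<j))))
  , subst₂ _<alt[ j ]_ (f≡f′ j ≤-refl) (g≡g′ j ≤-refl) fj<gj

≺alt[]-witness< : ∀ {f g j} n → 0 < n → (∀ i → f (n + i) ≡ f i) → (∀ i → g (n + i) ≡ g i) →
                  f ≺alt[ j ] g → j < n
≺alt[]-witness< {f} {g} {j} n n>0 f-periodic g-periodic (f≡g , fj<gj) with j <? n
... | yes j<n = j<n
... | no  j≮n = ⊥-elim (<alt⇒≢ {j} fj<gj (begin
  f j        ≡⟨ cong f n+k≡j ⟨
  f (n + k)  ≡⟨ f-periodic k ⟩
  f k        ≡⟨ f≡g k (subst (k <_) n+k≡j (m<n+m k n>0)) ⟩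
  g k        ≡⟨ g-periodic k ⟨
  g (n + k)  ≡⟨ cong g n+k≡j ⟩
  g j        ∎))
  where
  k : ℕ
  k = j ∸ n
  n+k≡j : n + k ≡ j
  n+k≡j = m+[n∸m]≡n (≮⇒≥ j≮n)

≺alt⇒⋡alt : ∀ {S T} → S ≺alt T → ¬ T ≼alt S
≺alt⇒⋡alt (_ , S≺T)         (inj₁ (_ , T≺S)) = ≺alt[]-asym S≺T T≺S
≺alt⇒⋡alt (j , _ , Sj<Tj) (inj₂ T=S)       = <alt⇒≢ {j} Sj<Tj (sym (T=S j))

opposite-orders⇒¬SPrefCond : ∀ W p → (Even p → take p W ≺alt W) → (¬ Even p → W ≺alt take p W) → ¬ SPrefCond W p
opposite-orders⇒¬SPrefCond W p P≺W W≺P (even-case , odd-case) with p % 2 ≟ 0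
... | yes even = ≺alt⇒⋡alt {take p W} {W} (P≺W even) (even-case even)
... | no  odd  = ≺alt⇒⋡alt {W} {take p W} (W≺P odd) (odd-case odd)

periodic-extension : ∀ (t : ℕ → ℕ) p .{{_ : NonZero p}} {j} → (∀ i → i < j → t i ≡ t (p + i)) →
                     ∀ i → i < p + j → t (i % p) ≡ t i
periodic-extension t p {j} periodic i i<p+j =
  trans (repeat (i / p) (i % p) (subst (_< p + j) i≡ i<p+j)) (cong t (sym i≡))
  where
  i≡ : i ≡ i % p + (i / p) * p
  i≡ = m≡m%n+[m/n]*n i p
  repeat : ∀ q r → r + q * p < p + j → t r ≡ t (r + q * p)
  repeat zero    r _  = cong t (sym (+-identityʳ r))
  repeat (suc q) r lt = begin
    t r                  ≡⟨ repeat q r (<-≤-trans r+qp<j (m≤n+m j p)) ⟩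
    t (r + q * p)        ≡⟨ periodic (r + q * p) r+qp<j ⟩
    t (p + (r + q * p))  ≡⟨ cong t (x∙yz≈y∙xz r p (q * p)) ⟨
    t (r + (p + q * p))  ∎
    where
    r+qp<j : r + q * p < j
    r+qp<j = +-cancelˡ-< p _ _ (subst (_< p + j) (x∙yz≈y∙xz r p (q * p)) lt)

-- Moving the first difference from j to p + j keeps its parity iff p is even.
periodic-extension-vs-shift : ∀ (t : ℕ → ℕ) p .{{_ : NonZero p}} {j} → t ≺alt[ j ] (λ i → t (p + i)) →
  (Even p → (λ i → t (i % p)) ≺alt[ p + j ] t) × (¬ Even p → t ≺alt[ p + j ] (λ i → t (i % p)))
periodic-extension-vs-shift t p {j} (periodic , tj<tpj) =
    (λ even → extension≡t , subst (_<alt[ p + j ] t (p + j)) (sym extension-at-p+j) (<alt-+even p j even tj<tpj))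
  , (λ odd → (λ i i<p+j → sym (extension≡t i i<p+j))
           , subst (t (p + j) <alt[ p + j ]_) (sym extension-at-p+j) (<alt-+odd p j odd tj<tpj))
  where
  extension≡t : ∀ i → i < p + j → t (i % p) ≡ t i
  extension≡t = periodic-extension t p periodic
  extension-at-p+j : t ((p + j) % p) ≡ t j
  extension-at-p+j = begin
    t ((p + j) % p)  ≡⟨ cong (λ k → t (k % p)) (+-comm p j) ⟩
    t ((j + p) % p)  ≡⟨ cong t ([m+n]%n≡m%n j p) ⟩
    t (j % p)        ≡⟨ extension≡t j (m<n+m j (>-nonZero⁻¹ p)) ⟩
    t j              ∎

at-drop : ∀ p w i → at (drop p w) i ≡ at w (p + i)
at-drop zero    w        i = refl
at-drop (suc p) []       i = refl
at-drop (suc p) (_ ∷ w)  i = at-drop p w i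

at-take : ∀ p w {i} → i < p → at (take p w) i ≡ at w i
at-take (suc p) []      _         = refl
at-take (suc p) (_ ∷ w) {zero}  _ = refl
at-take (suc p) (_ ∷ w) {suc i} (s≤s i<p) = at-take p w i<p

at-++ˡ : ∀ xs ys {i} → i < length xs → at (xs ++ ys) i ≡ at xs i
at-++ˡ (_ ∷ xs) ys {zero}  _         = refl
at-++ˡ (_ ∷ xs) ys {suc i} (s≤s i<n) = at-++ˡ xs ys i<n

at-++ʳ : ∀ xs ys {i} → length xs ≤ i → at (xs ++ ys) i ≡ at ys (i ∸ length xs)
at-++ʳ []       ys _         = refl
at-++ʳ (_ ∷ xs) ys (s≤s n≤i) = at-++ʳ xs ys n≤i

at-applyUpTo : ∀ (f : ℕ → ℕ) m {i} → i < m → at (applyUpTo f m) i ≡ f i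
at-applyUpTo f (suc m) {zero}  _         = refl
at-applyUpTo f (suc m) {suc i} (s≤s i<m) = at-applyUpTo (f ∘′ suc) m i<m

omega-< : ∀ w {i} → i < length w → omega w i ≡ at w i
omega-< w@(_ ∷ _) i<n = cong (at w) (m<n⇒m%n≡m i<n)

omega-% : ∀ w {n} i → length w ≡ suc n → omega w i ≡ at w (i % suc n)
omega-% (_ ∷ _) i refl = refl

omega-+length : ∀ w i → omega w (length w + i) ≡ omega w i
omega-+length []          i = refl
omega-+length w@(_ ∷ _) i =
  cong (at w) (trans (cong (_% length w) (+-comm (length w) i)) ([m+n]%n≡m%n i (length w)))

length-rot : ∀ p w → length (rot p w) ≡ length w
length-rot p w = begin
  length (drop p w ++ take p w)            ≡⟨ length-++ (drop p w) ⟩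
  length (drop p w) + length (take p w)    ≡⟨ +-comm (length (drop p w)) _ ⟩
  length (take p w) + length (drop p w)    ≡⟨ length-++ (take p w) ⟨
  length (take p w ++ drop p w)            ≡⟨ cong length (take++drop≡id p w) ⟩
  length w                                 ∎

at-rot : ∀ p w {i} → p ≤ length w → i < length w → at (rot p w) i ≡ omega w (p + i)
at-rot p w {i} p≤n i<n with i <? length w ∸ p
... | yes i<n∸p = begin
  at (drop p w ++ take p w) i  ≡⟨ at-++ˡ (drop p w) (take p w) (subst (i <_) (sym (length-drop p w)) i<n∸p) ⟩
  at (drop p w) i              ≡⟨ at-drop p w i ⟩
  at w (p + i)                 ≡⟨ omega-< w (subst (p + i <_) (m+[n∸m]≡n p≤n) (+-monoʳ-< p i<n∸p)) ⟨
  omega w (p + i)              ∎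
... | no  i≮n∸p = begin
  at (drop p w ++ take p w) i           ≡⟨ at-++ʳ (drop p w) (take p w) (subst (_≤ i) (sym (length-drop p w)) n∸p≤i) ⟩
  at (take p w) (i ∸ length (drop p w)) ≡⟨ cong (λ l → at (take p w) (i ∸ l)) (length-drop p w) ⟩
  at (take p w) k                       ≡⟨ at-take p w k<p ⟩
  at w k                                ≡⟨ omega-< w (<-≤-trans k<p p≤n) ⟨
  omega w k                             ≡⟨ omega-+length w k ⟨
  omega w (n + k)                       ≡⟨ cong (omega w) n+k≡p+i ⟩
  omega w (p + i)                       ∎
  where
  n : ℕ
  n = length w
  n∸p≤i : n ∸ p ≤ i
  n∸p≤i = ≮⇒≥ i≮n∸p
  k : ℕ
  k = i ∸ (n ∸ p)
  k<p : k < p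
  k<p = subst (k <_) (m∸[m∸n]≡n p≤n) (∸-monoˡ-< i<n n∸p≤i)
  n+k≡p+i : n + k ≡ p + i
  n+k≡p+i = begin
    n + (i ∸ (n ∸ p))  ≡⟨ +-∸-assoc n n∸p≤i ⟨
    (n + i) ∸ (n ∸ p)  ≡⟨ cong (_∸ (n ∸ p)) (+-comm n i) ⟩
    (i + n) ∸ (n ∸ p)  ≡⟨ +-∸-assoc i (m∸n≤m n p) ⟩
    i + (n ∸ (n ∸ p))  ≡⟨ cong (i +_) (m∸[m∸n]≡n p≤n) ⟩
    i + p              ≡⟨ +-comm i p ⟩
    p + i              ∎

omega-rot : ∀ p w {i} → p ≤ length w → i < length w → omega (rot p w) i ≡ omega w (p + i)
omega-rot p w {i} p≤n i<n =
  trans (omega-< (rot p w) (subst (i <_) (sym (length-rot p w)) i<n)) (at-rot p w p≤n i<n)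

length-pow : ∀ T m → length (pow T m) ≡ m
length-pow T m = trans (length-map (omega T) (applyUpTo id m)) (length-applyUpTo id m)

at-pow : ∀ T {m i} → i < m → at (pow T m) i ≡ omega T i
at-pow T {m} {i} i<m =
  trans (cong (λ w → at w i) (map-applyUpTo id (omega T) m)) (at-applyUpTo (omega T) m i<m)

omega-pow : ∀ T {m i} → i < m → omega (pow T m) i ≡ omega T i
omega-pow T {m} {i} i<m =
  trans (omega-< (pow T m) (subst (i <_) (sym (length-pow T m)) i<m)) (at-pow T i<m)

omega-take-pow : ∀ T {m} p i → suc p ≤ m → omega (take (suc p) (pow T m)) i ≡ omega T (i % suc p)
omega-take-pow T {m} p i p≤m = begin
  omega (take (suc p) W) i         ≡⟨ omega-% (take (suc p) W) i length-prefix ⟩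
  at (take (suc p) W) (i % suc p)  ≡⟨ at-take (suc p) W (m%n<n i (suc p)) ⟩
  at W (i % suc p)                 ≡⟨ at-pow T (<-≤-trans (m%n<n i (suc p)) p≤m) ⟩
  omega T (i % suc p)              ∎
  where
  W : Word
  W = pow T m
  length-prefix : length (take (suc p) W) ≡ suc p
  length-prefix = trans (length-take (suc p) W) (m≤n⇒m⊓n≡m (subst (suc p ≤_) (sym (length-pow T m)) p≤m))

¬SPrefCond-shorter-than-period : ∀ T m p → Galois T → 2 * length T ≤ m → suc p < length T →
                                 ¬ SPrefCond (pow T m) (suc p)
¬SPrefCond-shorter-than-period T m p′ galois 2n≤m p<n =
  opposite-orders⇒¬SPrefCond W p
    (λ even → p + j , ≺alt[]-local extension≡P t≡W (proj₁ extension-vs-shift even))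
    (λ odd  → p + j , ≺alt[]-local t≡W extension≡P (proj₂ extension-vs-shift odd))
  where
  p n : ℕ
  p = suc p′
  n = length T
  W : Word
  W = pow T m
  t : ℕ → ℕ
  t = omega T
  j : ℕ
  j = proj₁ (galois p z<s p<n)
  T≺rot : t ≺alt[ j ] omega (rot p T)
  T≺rot = proj₂ (galois p z<s p<n)
  rot-periodic : ∀ i → omega (rot p T) (n + i) ≡ omega (rot p T) i
  rot-periodic i = subst (λ l → omega (rot p T) (l + i) ≡ omega (rot p T) i) (length-rot p T) (omega-+length (rot p T) i)
  j<n : j < n
  j<n = ≺alt[]-witness< n (<-trans z<s p<n) (omega-+length T) rot-periodic T≺rot
  extension-vs-shift : (Even p → (λ i → t (i % p)) ≺alt[ p + j ] t) × (¬ Even p → t ≺alt[ p + j ] (λ i → t (i % p)))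
  extension-vs-shift = periodic-extension-vs-shift t p
    (≺alt[]-local (λ _ _ → refl) (λ i i≤j → omega-rot p T (<⇒≤ p<n) (≤-<-trans i≤j j<n)) T≺rot)
  p+j<m : p + j < m
  p+j<m = <-≤-trans (+-mono-< p<n j<n) (subst (λ l → n + l ≤ m) (+-identityʳ n) 2n≤m)
  extension≡P : ∀ i → i ≤ p + j → t (i % p) ≡ omega (take p W) i
  extension≡P i _ = sym (omega-take-pow T p′ i (<⇒≤ (≤-<-trans (m≤m+n p j) p+j<m)))
  t≡W : ∀ i → i ≤ p + j → t i ≡ omega W i
  t≡W i i≤p+j = sym (omega-pow T (≤-<-trans i≤p+j p+j<m))

lemma34 : (T : Word) → 0 < length T → Galois T →
    (m : ℕ) → 2 * length T ≤ m →
    (p : ℕ) → IsSPref (pow T m) p → length T ≤ p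
lemma34 T _ galois m 2n≤m zero    (() , _)
lemma34 T _ galois m 2n≤m (suc p) (_ , _ , condition , _) with length T ≤? suc p
... | yes n≤p = n≤p
... | no  n≰p = ⊥-elim (¬SPrefCond-shorter-than-period T m p galois 2n≤m (≰⇒> n≰p) condition)
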